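{- Let $G$ be a $2$-connected graph, let $u$ and $v$ be vertices of $G$, and let $\mathcal{C}_u$ be the set of cycles of $G$ that contain the vertex $u$. Then $\mathcal{P}_{\mathcal{C}_u}(G_{uv})$ is connected.
   Context: For a path $L$ and vertices $x,y$ on $L$, $L_{xy}$ denotes the subpath of $L$ joining $x$ and $y$. For vertices $u,v$ of a $2$-connected graph $G$, the $uv$ path graph $\mathcal{P}(G_{uv})$ has as vertices the paths in $G$ joining $u$ and $v$, where two such paths $S$ and $T$ are adjacent if $T$ is obtained from $S$ by replacing a subpath $S_{xy}$ of $S$ with a subpath $T_{xy}$ of $T$ internally disjoint from $S_{xy}$; in that case $S\cup T$ contains a unique cycle. For a set $\mathcal{C}$ of cycles of $G$, $\mathcal{P}_\mathcal{C}(G_{uv})$ is the spanning subgraph of $\mathcal{P}(G_{uv})$ in which adjacent paths $S,T$ remain adjacent if and only if the unique cycle contained in $S\cup T$ belongs to $\mathcal{C}$. -}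

module Defs where

open import Level using (0ℓ)
open import Data.Nat using (ℕ; _≤_)
open import Data.Fin using (Fin)
open import Data.Empty using (⊥)
open import Data.Bool using (Bool; true)
open import Data.List using (List; []; _∷_; _++_; reverse)
open import Data.List.Membership.Propositional using (_∈_; _∉_)
open import Data.List.Relation.Unary.Unique.Propositional using (Unique)
open import Data.Product using (Σ; ∃; ∃-syntax; _×_; proj₁)
open import Relation.Binary.PropositionalEquality using (_≡_; _≢_)
open import Relation.Binary.Construct.Closure.ReflexiveTransitive using (Star)

record Graph (n : ℕ) : Set where
  field
    adj    : Fin n → Fin n → Bool
    sym    : ∀ x y → adj x y ≡ adj y x
    irrefl : ∀ x → adj x x ≡ true → ⊥

open Graph public

module _ {n : ℕ} (G : Graph n) where

  Adj : Fin n → Fin n → Set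
  Adj x y = adj G x y ≡ true

  data Walk : Fin n → Fin n → List (Fin n) → Set where
    here : ∀ {x} → Walk x x (x ∷ [])
    step : ∀ {x y z L} → Adj x y → Walk y z L → Walk x z (x ∷ L)

  IsPath : Fin n → Fin n → List (Fin n) → Set
  IsPath x y L = Walk x y L × Unique L

  Connected : Set
  Connected = ∀ x y → ∃[ L ] IsPath x y L

  TwoConnected : Set
  TwoConnected =
    (3 ≤ n) × Connected ×
    (∀ w x y → x ≢ w → y ≢ w → ∃[ L ] (IsPath x y L × w ∉ L))

  UVPath : Fin n → Fin n → Set
  UVPath u v = Σ (List (Fin n)) (IsPath u v)

  Disjoint : List (Fin n) → List (Fin n) → Set
  Disjoint P Q = ∀ {z} → z ∈ P → z ∈ Q → ⊥

  -- Adjacency in P_C(G_uv), where a set C of cycles is given as a predicate on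
  -- cycles, a cycle being represented by its cyclic vertex sequence.
  -- T is obtained from S by replacing the subpath S_xy = x P y by the subpath
  -- T_xy = x Q y, internally disjoint from S_xy (P, Q disjoint), with S ≢ T.
  -- The unique cycle of S ∪ T is then S_xy ∪ T_xy, with cyclic vertex
  -- sequence  x P y (reverse Q); adjacency is kept iff this cycle is in C.
  PCAdj : (C : List (Fin n) → Set) → (S T : List (Fin n)) → Set
  PCAdj C S T =
    ∃[ A ] ∃[ B ] ∃[ x ] ∃[ y ] ∃[ P ] ∃[ Q ]
      ( S ≡ A ++ (x ∷ P) ++ (y ∷ B)
      × T ≡ A ++ (x ∷ Q) ++ (y ∷ B)
      × Disjoint P Q
      × S ≢ T
      × C ((x ∷ P) ++ (y ∷ reverse Q)) )

  PathGraphEdge : (C : List (Fin n) → Set) → (u v : Fin n) →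
                  UVPath u v → UVPath u v → Set
  PathGraphEdge C u v S T = PCAdj C (proj₁ S) (proj₁ T)

  PathGraphConnected : (C : List (Fin n) → Set) → (u v : Fin n) → Set
  PathGraphConnected C u v =
    UVPath u v × (∀ (S T : UVPath u v) → Star (PathGraphEdge C u v) S T)

  CyclesThrough : Fin n → List (Fin n) → Set
  CyclesThrough u c = u ∈ c

{-# OPTIONS --safe #-}
-- Let X = A x P y B and Y = A x Q y B be u–v paths differing by one reroute
-- (x P y replaced by the internally disjoint x Q y).  If A is empty then x = u
-- lies on the cycle x P y Q⁻¹, so X and Y are adjacent in P_{C_u}.  Otherwise
-- x ≠ u, and 2-connectivity gives a u–y path avoiding x; its first subpath
-- p M q leaving the prefix A (p ∈ A) and hitting the rest of X ∪ Y avoids both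
-- paths.  Rerouting X and Y through p M q gives intermediate paths, each related
-- to X or Y by a reroute after the strictly shorter prefix before p, so
-- induction on |A| joins X to Y.  Finally any two u–v paths X₁ y B and Y₁ y B
-- are joined by reroutes: if z is the last vertex of Y₁ on X, rerouting X
-- between z and y along Y lengthens the common suffix.
module Submission where

open import Level using (0ℓ)
open import Data.Fin using (Fin; zero; suc; _≟_)
open import Data.List using (List; []; _∷_; _++_; length; reverse)
open import Data.List.Membership.Propositional using (_∈_; _∉_; lose)
open import Data.List.Membership.Propositional.Properties using (∈-++⁺ˡ; ∈-++⁺ʳ; ∈-++⁻; ∈-∃++)
open import Data.List.Properties using (++-assoc; ≡-dec; ∷-injectiveˡ; ∷-injectiveʳ)
open import Data.List.Relation.Binary.Subset.Propositional using (_⊆_)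
import Data.List.Relation.Binary.Subset.Propositional.Properties as ⊆
open import Data.List.Relation.Unary.All as All using (All; []; _∷_)
open import Data.List.Relation.Unary.All.Properties using (¬Any⇒All¬; All¬⇒¬Any; ++⁻ˡ; ++⁻ʳ)
open import Data.List.Relation.Unary.AllPairs using ([]; _∷_)
open import Data.List.Relation.Unary.Any using (Any; here; there; any?)
open import Data.List.Relation.Unary.Any.Properties using (reverse⁺; reverse⁻)
open import Data.List.Relation.Unary.First as First using (FirstView)
open import Data.List.Relation.Unary.First.Properties using (cofirst?; toView; ¬First⇒All)
open import Data.List.Relation.Unary.Unique.Propositional using (Unique)
import Data.List.Relation.Unary.Unique.Propositional.Properties as Unique
open import Data.Nat using (ℕ; _+_; _<_; _≤_; s≤s; z≤n)
open import Data.Nat.Induction using (<-wellFounded)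
open import Data.Product using (∃-syntax; _×_; _,_; proj₁; proj₂; map₁; map₂; swap)
open import Data.Sum using (_⊎_; inj₁; inj₂; [_,_]′)
import Data.Sum as Sum
open import Function using (_∘_; _on_; flip; id)
open import Induction.WellFounded using (Acc; acc; WellFounded)
import Relation.Binary.Construct.On as On
open import Relation.Binary.Construct.Closure.ReflexiveTransitive using (Star; ε; _◅_; _◅◅_)
import Relation.Binary.Construct.Closure.ReflexiveTransitive as Star
open import Relation.Binary.PropositionalEquality using (_≡_; _≢_; refl; sym; trans; cong; subst; subst₂)
open import Relation.Nullary using (¬_; yes; no; contradiction)
open import Relation.Unary using (Pred; Decidable; ∁)

open import Defs hiding (sym)

module _ {A : Set} where

  private variable
    x y z : A
    xs ys zs ws : List A

  _⊏_ : List A → List A → Set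
  _⊏_ = _<_ on length

  ⊏-wellFounded : WellFounded _⊏_
  ⊏-wellFounded = On.wellFounded length <-wellFounded

  prefix-⊏ : ∀ xs → xs ⊏ (xs ++ y ∷ ys)
  prefix-⊏ []       = s≤s z≤n
  prefix-⊏ (_ ∷ xs) = s≤s (prefix-⊏ xs)

  ++-regroup : ∀ xs (y : A) ys (z : A) zs ws →
               (xs ++ y ∷ ys) ++ z ∷ zs ++ ws ≡ xs ++ y ∷ (ys ++ z ∷ zs) ++ ws
  ++-regroup xs y ys z zs ws
    rewrite ++-assoc xs (y ∷ ys) (z ∷ zs ++ ws) | ++-assoc ys (z ∷ zs) ws = refl

  ∈-cycle-swap : z ∈ (x ∷ xs) ++ y ∷ reverse ys → z ∈ (x ∷ ys) ++ y ∷ reverse xs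
  ∈-cycle-swap {xs = xs} {ys = ys} z∈ with ∈-++⁻ (_ ∷ xs) z∈
  ... | inj₁ (here z≡x)    = here z≡x
  ... | inj₁ (there z∈xs)  = ∈-++⁺ʳ (_ ∷ ys) (there (reverse⁺ z∈xs))
  ... | inj₂ (here z≡y)    = ∈-++⁺ʳ (_ ∷ ys) (here z≡y)
  ... | inj₂ (there z∈ys′) = there (∈-++⁺ˡ (reverse⁻ {xs = ys} z∈ys′))

  head-∈-prefix : ∀ xs → x ∷ ys ≡ xs ++ y ∷ zs → x ∈ xs ++ y ∷ []
  head-∈-prefix []      eq = here (∷-injectiveˡ eq)
  head-∈-prefix (_ ∷ _) eq = here (∷-injectiveˡ eq)

  Unique-++⁻ˡ : ∀ xs → Unique (xs ++ ys) → Unique xs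
  Unique-++⁻ˡ []       _         = []
  Unique-++⁻ˡ (x ∷ xs) (x∉ ∷ xs!) = ++⁻ˡ xs x∉ ∷ Unique-++⁻ˡ xs xs!

  Unique-++⁻ʳ : ∀ xs → Unique (xs ++ ys) → Unique ys
  Unique-++⁻ʳ []       xs!       = xs!
  Unique-++⁻ʳ (_ ∷ xs) (_ ∷ xs!) = Unique-++⁻ʳ xs xs!

  Unique-++⇒disjoint : ∀ xs → Unique (xs ++ ys) → z ∈ xs → z ∉ ys
  Unique-++⇒disjoint (_ ∷ xs) (x∉ ∷ _) (here refl) z∈ys =
    All.lookup (++⁻ʳ xs x∉) z∈ys refl
  Unique-++⇒disjoint (_ ∷ xs) (_ ∷ xs!) (there z∈xs) =
    Unique-++⇒disjoint xs xs! z∈xs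

  Unique-++⁺ : Unique xs → Unique ys → (∀ {z} → z ∈ xs → z ∉ ys) →
               Unique (xs ++ ys)
  Unique-++⁺ xs! ys! xs#ys = Unique.++⁺ xs! ys! λ (z∈xs , z∈ys) → xs#ys z∈xs z∈ys

  Unique-head : Unique (x ∷ xs) → x ∉ xs
  Unique-head = Unique.Unique[x∷xs]⇒x∉xs

  segment-disjoint : ∀ xs → Unique (xs ++ x ∷ ys ++ zs) → (∀ {z} → z ∈ ys → z ∉ ws) →
                     z ∈ ys → z ∉ xs ++ x ∷ ws
  segment-disjoint xs X! ys#ws z∈ys z∈ with ∈-++⁻ xs z∈
  ... | inj₁ z∈xs       = Unique-++⇒disjoint xs X! z∈xs (there (∈-++⁺ˡ z∈ys))
  ... | inj₂ (here refl) = Unique-head (Unique-++⁻ʳ xs X!) (∈-++⁺ˡ z∈ys)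
  ... | inj₂ (there z∈ws) = ys#ws z∈ys z∈ws

  ∈-prefix-unique : ∀ xs → Unique ((xs ++ z ∷ ys) ++ ws) → z ∈ zs ++ ws → z ∈ zs
  ∈-prefix-unique {zs = zs} xs Y! z∈ with ∈-++⁻ zs z∈
  ... | inj₁ z∈zs = z∈zs
  ... | inj₂ z∈ws =
    contradiction z∈ws (Unique-++⇒disjoint (xs ++ _ ∷ _) Y! (∈-++⁺ʳ xs (here refl)))

  module _ {P : Pred A 0ℓ} (P? : Decidable P) where

    first-view : Any P xs → FirstView (∁ P) P xs
    first-view {xs} p with cofirst? P? xs
    ... | yes first = toView first
    ... | no ¬first = contradiction p (All¬⇒¬Any (¬First⇒All id ¬first))

    data LastView : List A → Set where
      _⟨_⟩_ : ∀ xs → P y → All (∁ P) ys → LastView (xs ++ y ∷ ys)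

    last-view : Any P xs → LastView xs
    last-view {x ∷ xs} p with any? P? xs
    ... | yes p′ with last-view p′
    ...   | ys ⟨ py ⟩ ¬pzs = (x ∷ ys) ⟨ py ⟩ ¬pzs
    last-view (here px)  | no ¬p′ = [] ⟨ px ⟩ ¬Any⇒All¬ _ ¬p′
    last-view (there p′) | no ¬p′ = contradiction p′ ¬p′

nonzero-other-than : ∀ {n} (b : Fin (3 + n)) → ∃[ w ] (w ≢ zero × w ≢ b)
nonzero-other-than b with suc zero ≟ b
... | no 1≢b   = suc zero , (λ ()) , 1≢b
... | yes refl = suc (suc zero) , (λ ()) , (λ ())

third-vertex : ∀ {n} → 3 ≤ n → (a b : Fin n) → ∃[ w ] (w ≢ a × w ≢ b)
third-vertex (s≤s (s≤s (s≤s _))) a b with zero ≟ a | zero ≟ b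
... | no 0≢a   | no 0≢b   = zero , 0≢a , 0≢b
... | yes refl | _        = nonzero-other-than b
... | no _     | yes refl = map₂ swap (nonzero-other-than a)

module _ {n : ℕ} (G : Graph n) where

  private
    V = Fin n
    variable
      a b c m p q : V
      L L₁ L₂ M : List V

  Walk-head : Walk G a b (c ∷ L) → c ≡ a
  Walk-head here       = refl
  Walk-head (step _ _) = refl

  Walk-start∈ : Walk G a b L → a ∈ L
  Walk-start∈ here       = here refl
  Walk-start∈ (step _ _) = here refl

  Walk-end∈ : Walk G a b L → b ∈ L
  Walk-end∈ here       = here refl
  Walk-end∈ (step _ w) = there (Walk-end∈ w)

  Walk-cons : Walk G a b L → ∃[ L₁ ] L ≡ a ∷ L₁
  Walk-cons here       = [] , refl
  Walk-cons (step _ _) = _ , refl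

  Walk-snoc : Walk G a b L → ∃[ L₁ ] L ≡ L₁ ++ b ∷ []
  Walk-snoc here = [] , refl
  Walk-snoc (step _ w) with Walk-snoc w
  ... | L₁ , refl = _ ∷ L₁ , refl

  Walk-start∈prefix : ∀ L₁ → Walk G a b (L₁ ++ m ∷ L₂) → m ≢ a → a ∈ L₁
  Walk-start∈prefix []      w m≢a = contradiction (Walk-head w) m≢a
  Walk-start∈prefix (_ ∷ _) w _   = here (sym (Walk-head w))

  single-vertex-path : (S : UVPath G a a) → S ≡ (a ∷ [] , here , [] ∷ [])
  single-vertex-path (_ , here , [] ∷ [])  = refl
  single-vertex-path (_ , step _ w , S!) = contradiction (Walk-end∈ w) (Unique-head S!)

  Walk-split : ∀ L₁ → Walk G a b (L₁ ++ m ∷ L₂) →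
               Walk G a m (L₁ ++ m ∷ []) × Walk G m b (m ∷ L₂)
  Walk-split []           here       = here , here
  Walk-split []           (step e w) = here , step e w
  Walk-split (_ ∷ [])     (step e w) = map₁ (step e) (Walk-split [] w)
  Walk-split (_ ∷ c ∷ L₁) (step e w) = map₁ (step e) (Walk-split (c ∷ L₁) w)

  Walk-++ : ∀ L₁ → Walk G a m (L₁ ++ m ∷ []) → Walk G m b (m ∷ L₂) →
            Walk G a b (L₁ ++ m ∷ L₂)
  Walk-++ []           here        w₂ = w₂
  Walk-++ (_ ∷ [])     (step e here) w₂ = step e w₂
  Walk-++ (_ ∷ c ∷ L₁) (step e w₁) w₂ = step e (Walk-++ (c ∷ L₁) w₁ w₂)

  IsPath-split : ∀ L₁ → IsPath G a b (L₁ ++ m ∷ L₂) →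
                 IsPath G a m (L₁ ++ m ∷ []) × IsPath G m b (m ∷ L₂)
  IsPath-split L₁ (w , L!) =
    (proj₁ (Walk-split L₁ w) , Unique-++⁺ (Unique-++⁻ˡ L₁ L!) ([] ∷ []) L₁#m) ,
    (proj₂ (Walk-split L₁ w) , Unique-++⁻ʳ L₁ L!)
    where
      L₁#m : Disjoint G L₁ (_ ∷ [])
      L₁#m z∈L₁ (here refl) = Unique-++⇒disjoint L₁ L! z∈L₁ (here refl)

  IsPath-++ : ∀ L₁ → IsPath G a m (L₁ ++ m ∷ []) → IsPath G m b (m ∷ L₂) →
              Disjoint G L₁ (m ∷ L₂) → IsPath G a b (L₁ ++ m ∷ L₂)
  IsPath-++ L₁ (w₁ , L₁m!) (w₂ , mL₂!) L₁#mL₂ =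
    Walk-++ L₁ w₁ w₂ , Unique-++⁺ (Unique-++⁻ˡ L₁ L₁m!) mL₂! L₁#mL₂

  IsPath-infix : ∀ L₁ M → IsPath G a b (L₁ ++ p ∷ M ++ q ∷ L₂) →
                 IsPath G p q (p ∷ M ++ q ∷ [])
  IsPath-infix L₁ M path = proj₁ (IsPath-split (_ ∷ M) (proj₂ (IsPath-split L₁ path)))

  infix-⊆ : ∀ L₁ M → M ⊆ L₁ ++ p ∷ M ++ q ∷ L₂
  infix-⊆ L₁ M = ∈-++⁺ʳ L₁ ∘ there ∘ ∈-++⁺ˡ

  IsPath-splice : ∀ L₁ M′ → IsPath G a b (L₁ ++ p ∷ M′ ++ q ∷ L₂) →
                  IsPath G p q (p ∷ M ++ q ∷ []) → Disjoint G M (L₁ ++ p ∷ M′ ++ q ∷ L₂) →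
                  IsPath G a b (L₁ ++ p ∷ M ++ q ∷ L₂)
  IsPath-splice {M = M} L₁ M′ path detour M#path =
    IsPath-++ L₁ before (IsPath-++ (_ ∷ M) detour after pM#after) L₁#rest
    where
      path! = proj₂ path
      before = proj₁ (IsPath-split L₁ path)
      after  = proj₂ (IsPath-split (_ ∷ M′) (proj₂ (IsPath-split L₁ path)))
      pM#after : Disjoint G (_ ∷ M) (_ ∷ _)
      pM#after (here refl)  = Unique-++⇒disjoint (_ ∷ M′) (Unique-++⁻ʳ L₁ path!) (here refl)
      pM#after (there z∈M) = M#path z∈M ∘ ∈-++⁺ʳ L₁ ∘ there ∘ ∈-++⁺ʳ M′
      L₁#rest : Disjoint G L₁ (_ ∷ M ++ _ ∷ _)
      L₁#rest z∈L₁ (here refl) = Unique-++⇒disjoint L₁ path! z∈L₁ (here refl)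
      L₁#rest z∈L₁ (there z∈) with ∈-++⁻ M z∈
      ... | inj₁ z∈M   = M#path z∈M (∈-++⁺ˡ z∈L₁)
      ... | inj₂ z∈qL₂ = Unique-++⇒disjoint L₁ path! z∈L₁ (there (∈-++⁺ʳ M′ z∈qL₂))

  open import Data.List.Membership.DecPropositional (_≟_ {n}) using (_∈?_)

  Bridge : (As Zs L : List V) → Set
  Bridge As Zs L =
    ∃[ p ] ∃[ M ] ∃[ q ]
      ( p ∈ As × q ∈ Zs × Disjoint G M As × Disjoint G M Zs
      × IsPath G p q (p ∷ M ++ q ∷ []) × p ∷ M ++ q ∷ [] ⊆ L )

  bridge : ∀ {As Zs} → IsPath G a b L → a ∈ As → a ∉ Zs → b ∈ Zs → Bridge As Zs L
  bridge {a} {As = As} {Zs} path a∈As a∉Zs b∈Zs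
    with first-view (_∈? Zs) (lose (Walk-end∈ (proj₁ path)) b∈Zs)
  ... | First._++_∷_ {xs = L₀} outside q∈Zs L₂
    with a∈L₀ ← Walk-start∈prefix L₀ (proj₁ path) (λ q≡a → a∉Zs (subst (_∈ Zs) q≡a q∈Zs))
    with last-view (_∈? As) (lose a∈L₀ a∈As)
  ...   | _⟨_⟩_ {ys = M} L₁ p∈As inside =
    _ , M , _ , p∈As , q∈Zs ,
    (λ z∈M → All.lookup inside z∈M) ,
    (λ z∈M → All.lookup outside (∈-++⁺ʳ L₁ (there z∈M))) ,
    IsPath-infix L₁ M (subst (IsPath G a _) (++-assoc L₁ _ _) path) ,
    ⊆.++⁺ (⊆.xs⊆ys++xs _ L₁) (⊆.xs⊆xs++ys _ L₂)

module PathGraph {n : ℕ} (G : Graph n) (C : List (Fin n) → Set) (u v : Fin n) where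

  open import Data.List.Membership.DecPropositional (_≟_ {n}) using (_∈?_)

  private
    V = Fin n
    variable
      X Y : List V

  -- Elements of UVPath carry proofs, so distinct elements may share a vertex
  -- list; the argument runs on vertex lists and is transported by Linked⇒Star.
  Adjacent : List V → List V → Set
  Adjacent X Y = IsPath G u v X × IsPath G u v Y × PCAdj G C X Y

  Linked : List V → List V → Set
  Linked = Star Adjacent

  Linked⇒Star : (S T : UVPath G u v) → Linked (proj₁ S) (proj₁ T) →
                proj₁ S ≡ proj₁ T ⊎ Star (PathGraphEdge G C u v) S T
  Linked⇒Star S T ε = inj₁ refl
  Linked⇒Star S T (_◅_ {j = Z} (_ , Z-path , S—Z) Z~T) with Linked⇒Star (Z , Z-path) T Z~T
  ... | inj₁ refl = inj₂ (S—Z ◅ ε)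
  ... | inj₂ Z⇝T  = inj₂ (S—Z ◅ Z⇝T)

  -- The two lists below are adjacent in P(G_uv) unless equal; the hypothesis
  -- asks that they be joined in P_C.
  RerouteLinkedAt : List V → Set
  RerouteLinkedAt A =
    ∀ x P Q y B → Disjoint G P Q →
    IsPath G u v (A ++ x ∷ P ++ y ∷ B) → IsPath G u v (A ++ x ∷ Q ++ y ∷ B) →
    Linked (A ++ x ∷ P ++ y ∷ B) (A ++ x ∷ Q ++ y ∷ B)

  prefixes-empty : ∀ {y B} X₁ Y₁ →
                   IsPath G u v (X₁ ++ y ∷ B) → IsPath G u v (Y₁ ++ y ∷ B) →
                   ¬ Any (_∈ X₁ ++ y ∷ B) Y₁ → X₁ ≡ [] × Y₁ ≡ []
  prefixes-empty X₁       (_ ∷ _) (wX , _)  (wY , _) ¬meet =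
    contradiction (here (subst (_∈ _) (sym (Walk-head G wY)) (Walk-start∈ G wX))) ¬meet
  prefixes-empty []       []      _         _        _ = refl , refl
  prefixes-empty (_ ∷ X₁) []      (wX , X!) (wY , _) _ =
    contradiction (∈-++⁺ʳ X₁ (here (trans (Walk-head G wX) (sym (Walk-head G wY)))))
                  (Unique-head X!)

  module _ (reroute : ∀ A → RerouteLinkedAt A) where

    linked-with-common-suffix : ∀ {y B} X₁ Y₁ → Acc _⊏_ Y₁ →
                                IsPath G u v (X₁ ++ y ∷ B) → IsPath G u v (Y₁ ++ y ∷ B) →
                                Linked (X₁ ++ y ∷ B) (Y₁ ++ y ∷ B)
    linked-with-common-suffix {y} {B} X₁ Y₁ (acc rs) pX pY with any? (_∈? X₁ ++ y ∷ B) Y₁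
    ... | no ¬meet with refl , refl ← prefixes-empty X₁ Y₁ pX pY ¬meet = ε
    ... | yes meet with last-view (_∈? X₁ ++ y ∷ B) meet
    ...   | _⟨_⟩_ {y = z} {ys = Y₁b} Y₁a z∈X Y₁b#X
      with X₁a , X₁b , refl ← ∈-∃++ (∈-prefix-unique Y₁a (proj₂ pY) z∈X) =
      subst₂ Linked (sym eX) (sym eY) (X~W ◅◅ W~Y)
      where
        eX = ++-assoc X₁a (z ∷ X₁b) (y ∷ B)
        eY = ++-assoc Y₁a (z ∷ Y₁b) (y ∷ B)
        pX′ = subst (IsPath G u v) eX pX
        pY′ = subst (IsPath G u v) eY pY
        Y₁b#X′ : Disjoint G Y₁b (X₁a ++ z ∷ X₁b ++ y ∷ B)
        Y₁b#X′ z∈Y₁b z∈X = All.lookup Y₁b#X z∈Y₁b (subst (_ ∈_) (sym eX) z∈X)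
        pW = IsPath-splice G X₁a X₁b pX′ (IsPath-infix G Y₁a Y₁b pY′) Y₁b#X′
        X~W = reroute X₁a z X₁b Y₁b y B
                      (λ z∈X₁b z∈Y₁b → Y₁b#X′ z∈Y₁b (infix-⊆ G X₁a X₁b z∈X₁b)) pX′ pW
        W~Y = linked-with-common-suffix X₁a Y₁a (rs (prefix-⊏ Y₁a)) pW pY′

    reroutes-linked⇒linked : IsPath G u v X → IsPath G u v Y → Linked X Y
    reroutes-linked⇒linked pX pY with Walk-snoc G (proj₁ pX) | Walk-snoc G (proj₁ pY)
    ... | X₁ , refl | Y₁ , refl = linked-with-common-suffix X₁ Y₁ (⊏-wellFounded Y₁) pX pY

module TwoConnectedPaths {n : ℕ} (G : Graph n) (tc : TwoConnected G) (u v : Fin n) where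

  open PathGraph G (CyclesThrough G u) u v

  private
    V = Fin n

  avoiding : ∀ w a b → a ≢ w → b ≢ w → ∃[ L ] (IsPath G a b L × w ∉ L)
  avoiding = proj₂ (proj₂ tc)

  Adjacent-sym : ∀ {X Y} → Adjacent X Y → Adjacent Y X
  Adjacent-sym (pX , pY , A , B , x , y , P , Q , eX , eY , P#Q , X≢Y , u∈cycle) =
    pY , pX , A , B , x , y , Q , P , eY , eX , flip P#Q , X≢Y ∘ sym , ∈-cycle-swap u∈cycle

  reroute-at-start : RerouteLinkedAt []
  reroute-at-start x P Q y B P#Q pX pY with ≡-dec _≟_ (x ∷ P ++ y ∷ B) (x ∷ Q ++ y ∷ B)
  ... | yes X≡Y = subst (Linked _) X≡Y ε
  ... | no  X≢Y = X—Y ◅ ε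
    where
      u∈cycle = here (sym (Walk-head G (proj₁ pX)))
      X—Y : Adjacent (x ∷ P ++ y ∷ B) (x ∷ Q ++ y ∷ B)
      X—Y = pX , pY , [] , B , x , y , P , Q , refl , refl , P#Q , X≢Y , u∈cycle

  Detour : List V → V → List V → List V → V → List V → Set
  Detour A x P Q y B =
    ∃[ A₁ ] ∃[ p ] ∃[ A₂ ] ∃[ M ] ∃[ q ]
      ( A ≡ A₁ ++ p ∷ A₂ × IsPath G p q (p ∷ M ++ q ∷ [])
      × Disjoint G M (A ++ x ∷ P ++ y ∷ B) × Disjoint G M (A ++ x ∷ Q ++ y ∷ B)
      × (q ∈ P ⊎ q ∈ Q ⊎ q ∈ y ∷ B) )

  detour : ∀ A x P Q y B → u ∈ A →
           IsPath G u v (A ++ x ∷ P ++ y ∷ B) → IsPath G u v (A ++ x ∷ Q ++ y ∷ B) →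
           Detour A x P Q y B
  detour A x P Q y B u∈A (_ , X!) (_ , Y!) = via (avoiding x u y (u∉Xs ∘ here) y≢x)
    where
      Xs = x ∷ P ++ y ∷ B
      Ys = x ∷ Q ++ y ∷ B
      u∉Xs = Unique-++⇒disjoint A X! u∈A
      u∉Zs : u ∉ Xs ++ Ys
      u∉Zs u∈Zs = [ u∉Xs , Unique-++⇒disjoint A Y! u∈A ]′ (∈-++⁻ Xs u∈Zs)
      y≢x : y ≢ x
      y≢x y≡x = Unique-head (Unique-++⁻ʳ A X!) (∈-++⁺ʳ P (here (sym y≡x)))
      via : ∃[ L ] (IsPath G u y L × x ∉ L) → Detour A x P Q y B
      via (L , pL , x∉L)
        with p , M , q , p∈A , q∈Zs , M#A , M#Zs , pM , pM⊆L
               ← bridge G pL u∈A u∉Zs (∈-++⁺ˡ (there (∈-++⁺ʳ P (here refl))))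
        with A₁ , A₂ , A≡ ← ∈-∃++ p∈A =
        A₁ , p , A₂ , M , q , A≡ , pM , M#X , M#Y , lands (∈-++⁻ Xs q∈Zs)
        where
          M#X : Disjoint G M (A ++ Xs)
          M#X z∈M z∈X = [ M#A z∈M , M#Zs z∈M ∘ ∈-++⁺ˡ ]′ (∈-++⁻ A z∈X)
          M#Y : Disjoint G M (A ++ Ys)
          M#Y z∈M z∈Y = [ M#A z∈M , M#Zs z∈M ∘ ∈-++⁺ʳ Xs ]′ (∈-++⁻ A z∈Y)
          q≢x : q ≢ x
          q≢x q≡x = x∉L (subst (_∈ L) q≡x (pM⊆L (there (∈-++⁺ʳ M (here refl)))))
          lands : q ∈ Xs ⊎ q ∈ Ys → q ∈ P ⊎ q ∈ Q ⊎ q ∈ y ∷ B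
          lands (inj₁ (here q≡x))    = contradiction q≡x q≢x
          lands (inj₁ (there q∈PyB)) = Sum.map₂ inj₂ (∈-++⁻ P q∈PyB)
          lands (inj₂ (here q≡x))    = contradiction q≡x q≢x
          lands (inj₂ (there q∈QyB)) = inj₂ (∈-++⁻ Q q∈QyB)

  reroute-via-segment : ∀ A₁ p A₂ x P Q y B M q → RerouteLinkedAt A₁ →
    IsPath G p q (p ∷ M ++ q ∷ []) →
    Disjoint G M ((A₁ ++ p ∷ A₂) ++ x ∷ P ++ y ∷ B) →
    Disjoint G M ((A₁ ++ p ∷ A₂) ++ x ∷ Q ++ y ∷ B) →
    Disjoint G P Q → q ∈ P →
    IsPath G u v ((A₁ ++ p ∷ A₂) ++ x ∷ P ++ y ∷ B) →
    IsPath G u v ((A₁ ++ p ∷ A₂) ++ x ∷ Q ++ y ∷ B) →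
    Linked ((A₁ ++ p ∷ A₂) ++ x ∷ P ++ y ∷ B) ((A₁ ++ p ∷ A₂) ++ x ∷ Q ++ y ∷ B)
  reroute-via-segment A₁ p A₂ x P Q y B M q reroute pM M#X M#Y P#Q q∈P pX pY
    with P₁ , P₂ , refl ← ∈-∃++ q∈P =
    subst₂ Linked (sym eX) (sym eY) (X~R ◅◅ subst (λ R → Linked R _) (sym eR) R~Y)
    where
      eX = trans (cong (λ P → (A₁ ++ p ∷ A₂) ++ x ∷ P) (++-assoc P₁ (q ∷ P₂) (y ∷ B)))
                 (++-regroup A₁ p A₂ x P₁ (q ∷ P₂ ++ y ∷ B))
      eY = ++-regroup A₁ p A₂ x Q (y ∷ B)
      eR = cong (λ R → A₁ ++ p ∷ R) (sym (++-assoc M (q ∷ P₂) (y ∷ B)))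
      M#X′ : Disjoint G M (A₁ ++ p ∷ (A₂ ++ x ∷ P₁) ++ q ∷ P₂ ++ y ∷ B)
      M#X′ z∈M = M#X z∈M ∘ subst (_ ∈_) (sym eX)
      M#Y′ : Disjoint G M (A₁ ++ p ∷ (A₂ ++ x ∷ Q) ++ y ∷ B)
      M#Y′ z∈M = M#Y z∈M ∘ subst (_ ∈_) (sym eY)
      pX′ = subst (IsPath G u v) eX pX
      pR = IsPath-splice G A₁ (A₂ ++ x ∷ P₁) pX′ pM M#X′
      X~R = reroute p (A₂ ++ x ∷ P₁) M q (P₂ ++ y ∷ B)
                    (λ z∈old z∈M → M#X′ z∈M (infix-⊆ G A₁ _ z∈old)) pX′ pR
      new#old : Disjoint G (M ++ q ∷ P₂) (A₂ ++ x ∷ Q)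
      new#old z∈new z∈old with ∈-++⁻ M z∈new
      ... | inj₁ z∈M   = M#Y′ z∈M (infix-⊆ G A₁ _ z∈old)
      ... | inj₂ z∈qP₂ =
        segment-disjoint (A₁ ++ p ∷ A₂) (proj₂ pX) P#Q (∈-++⁺ʳ P₁ z∈qP₂)
                         (⊆.++⁺ˡ (x ∷ Q) (⊆.xs⊆ys++xs _ A₁ ∘ there) z∈old)
      R~Y = reroute p (M ++ q ∷ P₂) (A₂ ++ x ∷ Q) y B new#old
                    (subst (IsPath G u v) eR pR) (subst (IsPath G u v) eY pY)

  reroute-via-suffix : ∀ A₁ p A₂ x P Q Z M q → RerouteLinkedAt A₁ →
    IsPath G p q (p ∷ M ++ q ∷ []) →
    Disjoint G M ((A₁ ++ p ∷ A₂) ++ x ∷ P ++ Z) →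
    Disjoint G M ((A₁ ++ p ∷ A₂) ++ x ∷ Q ++ Z) →
    q ∈ Z →
    IsPath G u v ((A₁ ++ p ∷ A₂) ++ x ∷ P ++ Z) →
    IsPath G u v ((A₁ ++ p ∷ A₂) ++ x ∷ Q ++ Z) →
    Linked ((A₁ ++ p ∷ A₂) ++ x ∷ P ++ Z) ((A₁ ++ p ∷ A₂) ++ x ∷ Q ++ Z)
  reroute-via-suffix A₁ p A₂ x P Q Z M q reroute pM M#X M#Y q∈Z pX pY
    with Z₁ , Z₂ , refl ← ∈-∃++ q∈Z =
    subst₂ Linked (sym (regroup P)) (sym (regroup Q)) (X~R ◅◅ R~Y)
    where
      regroup : ∀ P → (A₁ ++ p ∷ A₂) ++ x ∷ P ++ Z₁ ++ q ∷ Z₂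
                    ≡ A₁ ++ p ∷ (A₂ ++ x ∷ P ++ Z₁) ++ q ∷ Z₂
      regroup P = trans (cong (λ P → (A₁ ++ p ∷ A₂) ++ x ∷ P) (sym (++-assoc P Z₁ (q ∷ Z₂))))
                        (++-regroup A₁ p A₂ x (P ++ Z₁) (q ∷ Z₂))
      M#X′ : Disjoint G M (A₁ ++ p ∷ (A₂ ++ x ∷ P ++ Z₁) ++ q ∷ Z₂)
      M#X′ z∈M = M#X z∈M ∘ subst (_ ∈_) (sym (regroup P))
      M#Y′ : Disjoint G M (A₁ ++ p ∷ (A₂ ++ x ∷ Q ++ Z₁) ++ q ∷ Z₂)
      M#Y′ z∈M = M#Y z∈M ∘ subst (_ ∈_) (sym (regroup Q))
      pX′ = subst (IsPath G u v) (regroup P) pX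
      pR = IsPath-splice G A₁ (A₂ ++ x ∷ P ++ Z₁) pX′ pM M#X′
      X~R = reroute p (A₂ ++ x ∷ P ++ Z₁) M q Z₂
                    (λ z∈old z∈M → M#X′ z∈M (infix-⊆ G A₁ _ z∈old)) pX′ pR
      R~Y = reroute p M (A₂ ++ x ∷ Q ++ Z₁) q Z₂
                    (λ z∈M z∈old → M#Y′ z∈M (infix-⊆ G A₁ _ z∈old))
                    pR (subst (IsPath G u v) (regroup Q) pY)

  reroute-linked-step : ∀ {A} → u ∈ A → (∀ {A₁} → A₁ ⊏ A → RerouteLinkedAt A₁) →
                        RerouteLinkedAt A
  reroute-linked-step {A} u∈A reroute x P Q y B P#Q pX pY
    with A₁ , p , A₂ , M , q , refl , pM , M#X , M#Y , lands ← detour A x P Q y B u∈A pX pY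
    with reroute-A₁ ← reroute {A₁} (prefix-⊏ A₁)
    with lands
  ... | inj₁ q∈P =
    reroute-via-segment A₁ p A₂ x P Q y B M q reroute-A₁ pM M#X M#Y P#Q q∈P pX pY
  ... | inj₂ (inj₁ q∈Q) = Star.reverse Adjacent-sym
    (reroute-via-segment A₁ p A₂ x Q P y B M q reroute-A₁ pM M#Y M#X (flip P#Q) q∈Q pY pX)
  ... | inj₂ (inj₂ q∈yB) =
    reroute-via-suffix A₁ p A₂ x P Q (y ∷ B) M q reroute-A₁ pM M#X M#Y q∈yB pX pY

  reroute-linked : ∀ A → Acc _⊏_ A → RerouteLinkedAt A
  reroute-linked []      _        = reroute-at-start
  reroute-linked (_ ∷ A) (acc rs) x P Q y B P#Q pX pY =
    reroute-linked-step (here (sym (Walk-head G (proj₁ pX))))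
                        (λ A₁⊏A → reroute-linked _ (rs A₁⊏A)) x P Q y B P#Q pX pY

  _⇝_ : UVPath G u v → UVPath G u v → Set
  _⇝_ = Star (PathGraphEdge G (CyclesThrough G u) u v)

  reroutes-linked : ∀ A → RerouteLinkedAt A
  reroutes-linked A = reroute-linked A (⊏-wellFounded A)

  distinct-paths-connected : ∀ S T → proj₁ S ≢ proj₁ T → S ⇝ T
  distinct-paths-connected S T S≢T
    with Linked⇒Star S T (reroutes-linked⇒linked reroutes-linked (proj₂ S) (proj₂ T))
  ... | inj₁ S≡T = contradiction S≡T S≢T
  ... | inj₂ S⇝T = S⇝T

  path-avoiding-edge : u ≢ v → ∃[ R ] (IsPath G u v R × ∀ T → u ∷ v ∷ T ≢ R)
  path-avoiding-edge u≢v
    with w , w≢u , w≢v ← third-vertex (proj₁ tc) u v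
    with L , pL , v∉L ← avoiding v u w u≢v w≢v
    with K , pK , u∉K ← avoiding u w v w≢u (u≢v ∘ sym)
    with bridge G {As = u ∷ []} pL (here refl) u∉K (Walk-start∈ G (proj₁ pK))
  ... | _ , _ , _ , there () , _
  ... | _ , M , q , here refl , q∈K , _ , M#K , pM , pM⊆L
    with K₁ , K₂ , refl ← ∈-∃++ q∈K =
    u ∷ M ++ q ∷ K₂ , IsPath-++ G (u ∷ M) pM (proj₂ (IsPath-split G K₁ pK)) uM#qK₂ ,
    λ T uvT≡R → v∉L (pM⊆L (there (head-∈-prefix M (∷-injectiveʳ uvT≡R))))
    where
      uM#qK₂ : Disjoint G (u ∷ M) (q ∷ K₂)
      uM#qK₂ (here refl) = u∉K ∘ ∈-++⁺ʳ K₁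
      uM#qK₂ (there z∈M) = M#K z∈M ∘ ∈-++⁺ʳ K₁

  another-path : u ≢ v → ∀ S → IsPath G u v S → ∃[ R ] (IsPath G u v R × S ≢ R)
  another-path u≢v _ (here , _) = contradiction refl u≢v
  another-path u≢v (_ ∷ S) (step {y = d} _ w , S!) with d ≟ v
  ... | no d≢v = around (avoiding d u v u≢d (d≢v ∘ sym))
    where
      u≢d : u ≢ d
      u≢d u≡d = Unique-head S! (subst (_∈ S) (sym u≡d) (Walk-start∈ G w))
      around : ∃[ R ] (IsPath G u v R × d ∉ R) → ∃[ R ] (IsPath G u v R × u ∷ S ≢ R)
      around (R , pR , d∉R) =
        R , pR , λ uS≡R → d∉R (subst (d ∈_) uS≡R (there (Walk-start∈ G w)))
  ... | yes refl
    with T , refl ← Walk-cons G w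
    with R , pR , R≢uvT ← path-avoiding-edge u≢v = R , pR , R≢uvT T

corollary10 : ∀ {n : ℕ} (G : Graph n) → TwoConnected G → (u v : Fin n) →
                PathGraphConnected G (CyclesThrough G u) u v
corollary10 G tc u v = proj₁ (proj₂ tc) u v , connect
  where
    open TwoConnectedPaths G tc u v

    connect : ∀ S T → S ⇝ T
    connect S T with ≡-dec _≟_ (proj₁ S) (proj₁ T) | u ≟ v
    ... | no S≢T  | _        = distinct-paths-connected S T S≢T
    ... | yes _   | yes refl
      with refl ← single-vertex-path G S | refl ← single-vertex-path G T = ε
    ... | yes S≡T | no u≢v
      with R , pR , S≢R ← another-path u≢v (proj₁ S) (proj₂ S) =
      distinct-paths-connected S (R , pR) S≢R ◅◅
      distinct-paths-connected (R , pR) T (S≢R ∘ trans S≡T ∘ sym)
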